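{- Let $n,D,k$ be integers with $n\ge 5$, $4\le D\le n-1$ and $0\le k\le n-D-1$, and let $f(n,D)=\max_{0\le j\le n-D-1}\xi^c(G_{n,D,j})$. (i) If $n<3(D-1)$, then $\xi^c(G_{n,D,k})=f(n,D)$ if and only if $k=n-D-1$. (ii) If $n>3(D-1)$, then $\xi^c(G_{n,D,k})=f(n,D)$ if and only if $k=0$. (iii) If $n=3(D-1)$, then $\xi^c(G_{n,D,k})=f(n,D)$ for every $k\in\{0,\ldots,n-D-1\}$.
   Context: For a connected graph $G=(V,E)$, $\mathrm{ecc}(v)=\max_{w\in V}\mathrm{dist}(v,w)$ and $\xi^c(G)=\sum_{v\in V}\deg(v)\,\mathrm{ecc}(v)$. For integers $n\ge4$, $3\le D\le n-1$, $0\le k\le n-D-1$, the graph $G_{n,D,k}$ is constructed from a path $u_0-u_1-\cdots-u_D$ and a disjoint clique $K_{n-D-1}$ by joining every vertex of the clique to $u_0$ and $u_1$, and joining $k$ of the clique vertices to $u_2$. -}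

module Defs where

open import Data.Nat using (ℕ; zero; suc; _+_; _*_; _∸_; _⊔_; _<ᵇ_; _≡ᵇ_)
open import Data.Bool using (Bool; true; false; _∧_; _∨_; if_then_else_; not)
open import Data.Fin using (Fin; toℕ)
open import Data.List using (List; map; foldr; upTo; allFin)
open import Data.Nat.ListAction using (sum)
open import Data.Bool.ListAction using (any)

-- Finite simple graphs on vertex set Fin n, given by a (symmetric,
-- irreflexive) Boolean adjacency function.

Graph : ℕ → Set
Graph n = Fin n → Fin n → Bool

vertices : (n : ℕ) → List (Fin n)
vertices n = allFin n

_==_ : {n : ℕ} → Fin n → Fin n → Bool
v == w = toℕ v ≡ᵇ toℕ w

deg : {n : ℕ} → Graph n → Fin n → ℕ
deg {n} G v = sum (map (λ w → if G v w then 1 else 0) (vertices n))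

reach : {n : ℕ} → Graph n → Fin n → ℕ → Fin n → Bool
reach G v zero    w = v == w
reach {n} G v (suc d) w = reach G v d w ∨ any (λ u → reach G v d u ∧ G u w) (vertices n)

-- distance: least d with w reachable from v by a walk of length ≤ d
-- (searched among d = 0,…,n; for connected graphs dist < n always,
--  so the fallback value n is never used)
distFrom : {n : ℕ} → Graph n → Fin n → Fin n → ℕ → ℕ → ℕ
distFrom G v w d zero      = d
distFrom G v w d (suc fuel) = if reach G v d w then d else distFrom G v w (suc d) fuel

dist : {n : ℕ} → Graph n → Fin n → Fin n → ℕ
dist {n} G v w = distFrom G v w 0 n

ecc : {n : ℕ} → Graph n → Fin n → ℕ
ecc {n} G v = foldr (λ w m → dist G v w ⊔ m) 0 (vertices n)

ξc : {n : ℕ} → Graph n → ℕ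
ξc {n} G = sum (map (λ v → deg G v * ecc G v) (vertices n))

-- Vertex i (as a natural number) with i ≤ D is the path vertex u_i;
-- vertices D+1, …, n-1 form the clique K_{n-D-1}; clique vertex D+1+j
-- is joined to u_2 iff j < k (so exactly k clique vertices, when k ≤ n-D-1).

isPath : ℕ → ℕ → Bool
isPath D i = i <ᵇ suc D

pathClique : ℕ → ℕ → ℕ → ℕ → Bool
pathClique D k i c = (i ≡ᵇ 0) ∨ (i ≡ᵇ 1) ∨ ((i ≡ᵇ 2) ∧ ((c ∸ suc D) <ᵇ k))

adjℕ : ℕ → ℕ → ℕ → ℕ → Bool
adjℕ D k i j with isPath D i | isPath D j
... | true  | true  = (suc i ≡ᵇ j) ∨ (suc j ≡ᵇ i)
... | false | false = not (i ≡ᵇ j)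
... | true  | false = pathClique D k i j
... | false | true  = pathClique D k j i

Gndk : (n D k : ℕ) → Graph n
Gndk n D k v w = adjℕ D k (toℕ v) (toℕ w)

f : ℕ → ℕ → ℕ
f n D = foldr (λ j m → ξc (Gndk n D j) ⊔ m) 0 (upTo (suc (n ∸ D ∸ 1)))

-- In G_{n,D,k} (D ≥ 2) the graph distance has a closed form: ∣i − j∣ between path vertices
-- u_i and u_j, 1 + (i ∸ h) from a clique vertex to u_i, where u_h (h = 2 if the vertex is
-- joined to u₂, h = 1 otherwise) is its last neighbour on the path, and 1 between distinct
-- clique vertices.  This function vanishes only on the diagonal, grows by at most one along
-- an edge and drops by one along some edge, so it is the breadth-first distance.  Hence
-- ecc(u_i) = max(i, D − i), and a clique vertex has eccentricity D − 1 if it is joined to u₂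
-- and D otherwise.  Raising k only adds the edge from u₂ to one more clique vertex, and
-- summing degree × eccentricity shows that for D ≥ 4
--   ξ^c(G_{n,D,k+1}) − ξ^c(G_{n,D,k}) = 3(D − 1) − n.
-- So k ↦ ξ^c(G_{n,D,k}) is an arithmetic progression on 0 ≤ k ≤ n − D − 1, and its maximum is
-- attained only at the top, only at the bottom, or everywhere, according to the sign of
-- 3(D − 1) − n.

module Submission where

open import Defs
open import Algebra.Properties.CommutativeSemigroup using (interchange)
open import Data.Bool using (Bool; true; false; T; not; _∨_; if_then_else_)
open import Data.Bool.Properties using (T-∨; T-∧)
open import Data.Fin using (Fin; toℕ; fromℕ<) renaming (zero to fzero; suc to fsuc)
open import Data.Fin.Properties using (toℕ-injective; toℕ<n; toℕ-fromℕ<)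
open import Data.List using (foldr; map; tabulate; applyUpTo)
open import Data.List.Relation.Unary.Any using (satisfied)
open import Data.List.Relation.Unary.Any.Properties using (any⁺; any⁻; tabulate⁺)
open import Data.Nat
  using (ℕ; zero; suc; _+_; _*_; _∸_; _⊔_; _≤_; _<_; _>_; z≤n; s≤s; _≡ᵇ_; _<ᵇ_; ∣_-_∣; _≟_; _≤?_)
open import Data.Nat.ListAction using (sum)
open import Data.Nat.Properties
open import Data.Nat.Tactic.RingSolver using (solve-∀)
open import Data.Product using (_×_; _,_; ∃-syntax)
open import Data.Sum using (_⊎_; inj₁; inj₂)
open import Function using (_∘_; id)
open import Function.Bundles using (_⇔_; mk⇔; Equivalence)
open import Relation.Nullary using (yes; no; contradiction)
open import Relation.Binary.PropositionalEquality
  using (_≡_; _≢_; refl; sym; trans; cong; cong₂; subst; subst₂; module ≡-Reasoning)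

open Equivalence using (to; from)

[_] : Bool → ℕ
[ b ] = if b then 1 else 0

sumTo : (ℕ → ℕ) → ℕ → ℕ
sumTo F zero    = 0
sumTo F (suc N) = F 0 + sumTo (F ∘ suc) N

maxTo : (ℕ → ℕ) → ℕ → ℕ
maxTo F zero    = 0
maxTo F (suc N) = F 0 ⊔ maxTo (F ∘ suc) N

sumTo-cong : ∀ N {F G : ℕ → ℕ} → (∀ i → i < N → F i ≡ G i) → sumTo F N ≡ sumTo G N
sumTo-cong zero    F≡G = refl
sumTo-cong (suc N) F≡G = cong₂ _+_ (F≡G 0 (s≤s z≤n)) (sumTo-cong N (λ i i<N → F≡G (suc i) (s≤s i<N)))

sumTo-const : ∀ N c → sumTo (λ _ → c) N ≡ N * c
sumTo-const zero    c = refl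
sumTo-const (suc N) c = cong (c +_) (sumTo-const N c)

sumTo-+ : ∀ N (F G : ℕ → ℕ) → sumTo (λ i → F i + G i) N ≡ sumTo F N + sumTo G N
sumTo-+ zero    F G = refl
sumTo-+ (suc N) F G =
  trans (cong (F 0 + G 0 +_) (sumTo-+ N (F ∘ suc) (G ∘ suc))) (interchange +-commutativeSemigroup (F 0) (G 0) _ _)

sumTo-+ˡ : ∀ a b (F : ℕ → ℕ) → sumTo F (a + b) ≡ sumTo F a + sumTo (λ i → F (a + i)) b
sumTo-+ˡ zero    b F = refl
sumTo-+ˡ (suc a) b F = trans (cong (F 0 +_) (sumTo-+ˡ a b (F ∘ suc))) (sym (+-assoc (F 0) _ _))

sumTo-zero : ∀ N → sumTo (λ _ → 0) N ≡ 0
sumTo-zero N = trans (sumTo-const N 0) (*-zeroʳ N)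

sumTo-<ᵇ : ∀ {k m} → k ≤ m → sumTo (λ j → [ j <ᵇ k ]) m ≡ k
sumTo-<ᵇ {zero}  {m}     _         = sumTo-zero m
sumTo-<ᵇ {suc k} {suc m} (s≤s k≤m) = cong suc (sumTo-<ᵇ k≤m)

sumTo-if-<ᵇ : ∀ {k m} A B → k ≤ m →
              sumTo (λ j → if j <ᵇ k then A else B) m ≡ k * A + (m ∸ k) * B
sumTo-if-<ᵇ {zero}  {m}     A B _         = sumTo-const m B
sumTo-if-<ᵇ {suc k} {suc m} A B (s≤s k≤m) =
  trans (cong (A +_) (sumTo-if-<ᵇ A B k≤m)) (sym (+-assoc A (k * A) _))

1+sumTo-≢ : ∀ {j m} → j < m → suc (sumTo (λ i → [ not (j ≡ᵇ i) ]) m) ≡ m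
1+sumTo-≢ {zero}  {suc m} _         = cong suc (trans (sumTo-const m 1) (*-identityʳ m))
1+sumTo-≢ {suc j} {suc m} (s≤s j<m) = cong suc (1+sumTo-≢ j<m)

maxTo-least : ∀ N (F : ℕ → ℕ) {b} → (∀ i → i < N → F i ≤ b) → maxTo F N ≤ b
maxTo-least zero    F F≤b = z≤n
maxTo-least (suc N) F F≤b =
  ⊔-lub (F≤b 0 (s≤s z≤n)) (maxTo-least N (F ∘ suc) (λ i i<N → F≤b (suc i) (s≤s i<N)))

maxTo-upper : ∀ N (F : ℕ → ℕ) {i} → i < N → F i ≤ maxTo F N
maxTo-upper (suc N) F {zero}  _           = m≤m⊔n (F 0) _
maxTo-upper (suc N) F {suc i} (s≤s i<N) = ≤-trans (maxTo-upper N (F ∘ suc) i<N) (m≤n⊔m (F 0) _)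

maxTo-attained : ∀ N (F : ℕ → ℕ) {i} → i < N → (∀ j → j < N → F j ≤ F i) → maxTo F N ≡ F i
maxTo-attained N F i<N F≤Fi = ≤-antisym (maxTo-least N F F≤Fi) (maxTo-upper N F i<N)

sum-tabulate : ∀ {A : Set} N (g : Fin N → A) (h : A → ℕ) (F : ℕ → ℕ) →
               (∀ i → h (g i) ≡ F (toℕ i)) → sum (map h (tabulate g)) ≡ sumTo F N
sum-tabulate zero    g h F hg≡F = refl
sum-tabulate (suc N) g h F hg≡F =
  cong₂ _+_ (hg≡F fzero) (sum-tabulate N (g ∘ fsuc) h (F ∘ suc) (hg≡F ∘ fsuc))

foldr-⊔-tabulate : ∀ {A : Set} N (g : Fin N → A) (h : A → ℕ) (F : ℕ → ℕ) →
                   (∀ i → h (g i) ≡ F (toℕ i)) → foldr (λ x m → h x ⊔ m) 0 (tabulate g) ≡ maxTo F N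
foldr-⊔-tabulate zero    g h F hg≡F = refl
foldr-⊔-tabulate (suc N) g h F hg≡F =
  cong₂ _⊔_ (hg≡F fzero) (foldr-⊔-tabulate N (g ∘ fsuc) h (F ∘ suc) (hg≡F ∘ fsuc))

foldr-⊔-applyUpTo : ∀ N (g h : ℕ → ℕ) →
                    foldr (λ x m → h x ⊔ m) 0 (applyUpTo g N) ≡ maxTo (h ∘ g) N
foldr-⊔-applyUpTo zero    g h = refl
foldr-⊔-applyUpTo (suc N) g h = cong (h (g 0) ⊔_) (foldr-⊔-applyUpTo N (g ∘ suc) h)

module Progression (a : ℕ → ℕ) (m c d : ℕ) (step : ∀ j → j < m → a (suc j) + c ≡ a j + d) where

  step-< : c < d → ∀ j → j < m → a j < a (suc j)
  step-< c<d j j<m =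
    +-cancelʳ-< c (a j) (a (suc j)) (subst (a j + c <_) (sym (step j j<m)) (+-monoʳ-< (a j) c<d))

  step-> : d < c → ∀ j → j < m → a (suc j) < a j
  step-> d<c j j<m =
    +-cancelʳ-< d (a (suc j)) (a j) (subst (a (suc j) + d <_) (step j j<m) (+-monoʳ-< (a (suc j)) d<c))

  increasing : c < d → ∀ {i j} → i < j → j ≤ m → a i < a j
  increasing c<d {i} {suc j} i<1+j 1+j≤m with m≤n⇒m<n∨m≡n (≤-pred i<1+j)
  ... | inj₁ i<j  = <-trans (increasing c<d i<j (<⇒≤ 1+j≤m)) (step-< c<d j 1+j≤m)
  ... | inj₂ refl = step-< c<d j 1+j≤m

  decreasing : d < c → ∀ {j} → 0 < j → j ≤ m → a j < a 0
  decreasing d<c {suc zero}    _ 1≤m   = step-> d<c 0 1≤m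
  decreasing d<c {suc (suc j)} _ 2+j≤m =
    <-trans (step-> d<c (suc j) 2+j≤m) (decreasing d<c (s≤s z≤n) (<⇒≤ 2+j≤m))

  constant : c ≡ d → ∀ j → j ≤ m → a j ≡ a 0
  constant c≡d zero    _     = refl
  constant c≡d (suc j) 1+j≤m =
    trans (+-cancelʳ-≡ c _ _ (trans (step j 1+j≤m) (cong (a j +_) (sym c≡d))))
          (constant c≡d j (<⇒≤ 1+j≤m))

  maximum-top : c < d → maxTo a (suc m) ≡ a m
  maximum-top c<d = maxTo-attained (suc m) a ≤-refl a≤Tm
    where
    a≤Tm : ∀ j → j < suc m → a j ≤ a m
    a≤Tm j j<1+m with m≤n⇒m<n∨m≡n (≤-pred j<1+m)
    ... | inj₁ j<m  = <⇒≤ (increasing c<d j<m ≤-refl)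
    ... | inj₂ refl = ≤-refl

  maximum-bottom : d < c → maxTo a (suc m) ≡ a 0
  maximum-bottom d<c = maxTo-attained (suc m) a (s≤s z≤n) a≤T0
    where
    a≤T0 : ∀ j → j < suc m → a j ≤ a 0
    a≤T0 zero    _        = ≤-refl
    a≤T0 (suc j) 1+j<1+m = <⇒≤ (decreasing d<c (s≤s z≤n) (≤-pred 1+j<1+m))

  maximum-constant : c ≡ d → ∀ k → k ≤ m → maxTo a (suc m) ≡ a k
  maximum-constant c≡d k k≤m =
    trans (maxTo-attained (suc m) a (s≤s z≤n) (λ j j<1+m → ≤-reflexive (constant c≡d j (≤-pred j<1+m))))
          (sym (constant c≡d k k≤m))

  argmax-top : c < d → ∀ {k} → k ≤ m → a k ≡ maxTo a (suc m) ⇔ k ≡ m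
  argmax-top c<d {k} k≤m = mk⇔ k≡m (λ { refl → sym (maximum-top c<d) })
    where
    k≡m : a k ≡ maxTo a (suc m) → k ≡ m
    k≡m aₖ≡max with m≤n⇒m<n∨m≡n k≤m
    ... | inj₁ k<m =
      contradiction (trans aₖ≡max (maximum-top c<d)) (<⇒≢ (increasing c<d k<m ≤-refl))
    ... | inj₂ k≡m = k≡m

  argmax-bottom : d < c → ∀ {k} → k ≤ m → a k ≡ maxTo a (suc m) ⇔ k ≡ 0
  argmax-bottom d<c k≤m = mk⇔ (k≡0 k≤m) (λ { refl → sym (maximum-bottom d<c) })
    where
    k≡0 : ∀ {k} → k ≤ m → a k ≡ maxTo a (suc m) → k ≡ 0
    k≡0 {zero}  _   _      = refl
    k≡0 {suc _} k≤m aₖ≡max =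
      contradiction (trans aₖ≡max (maximum-bottom d<c)) (<⇒≢ (decreasing d<c (s≤s z≤n) k≤m))

module DistanceCharacterisation {n} (G : Graph n) (v : Fin n) (δ : Fin n → ℕ)
  (δ-source : δ v ≡ 0)
  (δ≡0⇒source : ∀ w → δ w ≡ 0 → v ≡ w)
  (δ-edge : ∀ u w → T (G u w) → δ w ≤ suc (δ u))
  (δ-predecessor : ∀ w d → δ w ≡ suc d → ∃[ u ] T (G u w) × δ u ≡ d) where

  reach⇒δ≤ : ∀ d w → T (reach G v d w) → δ w ≤ d
  reach⇒δ≤ zero    w v==w =
    ≤-reflexive (subst (λ x → δ x ≡ 0) (toℕ-injective (≡ᵇ⇒≡ _ _ v==w)) δ-source)
  reach⇒δ≤ (suc d) w r with to T-∨ r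
  ... | inj₁ r′ = m≤n⇒m≤1+n (reach⇒δ≤ d w r′)
  ... | inj₂ r′ with satisfied (any⁻ _ (vertices n) r′)
  ... | u , ru∧Guw with to T-∧ ru∧Guw
  ... | ru , Guw = ≤-trans (δ-edge u w Guw) (s≤s (reach⇒δ≤ d u ru))

  δ≤⇒reach : ∀ d w → δ w ≤ d → T (reach G v d w)
  δ≤⇒reach zero    w δw≤0 = ≡⇒≡ᵇ _ _ (cong toℕ (δ≡0⇒source w (n≤0⇒n≡0 δw≤0)))
  δ≤⇒reach (suc d) w δw≤1+d with m≤n⇒m<n∨m≡n δw≤1+d
  ... | inj₁ δw≤d  = from T-∨ (inj₁ (δ≤⇒reach d w (≤-pred δw≤d)))
  ... | inj₂ δw≡1+d with δ-predecessor w d δw≡1+d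
  ... | u , Guw , δu≡d =
    from T-∨ (inj₂ (any⁺ _ (tabulate⁺ u (from T-∧ (δ≤⇒reach d u (≤-reflexive δu≡d) , Guw)))))

  distFrom≡δ : ∀ fuel d w → d ≤ δ w → δ w < d + fuel → distFrom G v w d fuel ≡ δ w
  distFrom≡δ zero       d w d≤δw δw<d+0 =
    contradiction (subst (δ w <_) (+-identityʳ d) δw<d+0) (≤⇒≯ d≤δw)
  distFrom≡δ (suc fuel) d w d≤δw δw<d+1+fuel with reach G v d w in r
  ... | true  = ≤-antisym d≤δw (reach⇒δ≤ d w (subst T (sym r) _))
  ... | false = distFrom≡δ fuel (suc d) w d<δw (subst (δ w <_) (+-suc d fuel) δw<d+1+fuel)
    where
    d<δw : d < δ w
    d<δw = ≰⇒> (λ δw≤d → subst T r (δ≤⇒reach d w δw≤d))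

  dist≡δ : ∀ w → δ w < n → dist G v w ≡ δ w
  dist≡δ w δw<n = distFrom≡δ n 0 w z≤n δw<n

∣i-1+j∣≤1+∣i-j∣ : ∀ i j → ∣ i - suc j ∣ ≤ suc ∣ i - j ∣
∣i-1+j∣≤1+∣i-j∣ zero    j       = ≤-refl
∣i-1+j∣≤1+∣i-j∣ (suc i) zero    = ≤-trans (≤-reflexive (∣-∣-identityʳ i)) (m≤n⇒m≤1+n (n≤1+n i))
∣i-1+j∣≤1+∣i-j∣ (suc i) (suc j) = ∣i-1+j∣≤1+∣i-j∣ i j

∣i-j∣≤1+∣i-1+j∣ : ∀ i j → ∣ i - j ∣ ≤ suc ∣ i - suc j ∣
∣i-j∣≤1+∣i-1+j∣ zero    j       = m≤n⇒m≤1+n (n≤1+n j)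
∣i-j∣≤1+∣i-1+j∣ (suc i) zero    = s≤s (≤-reflexive (sym (∣-∣-identityʳ i)))
∣i-j∣≤1+∣i-1+j∣ (suc i) (suc j) = ∣i-j∣≤1+∣i-1+j∣ i j

m∸n≤1+m∸[1+n] : ∀ m n → m ∸ n ≤ suc (m ∸ suc n)
m∸n≤1+m∸[1+n] zero    zero    = z≤n
m∸n≤1+m∸[1+n] zero    (suc n) = z≤n
m∸n≤1+m∸[1+n] (suc m) zero    = ≤-refl
m∸n≤1+m∸[1+n] (suc m) (suc n) = m∸n≤1+m∸[1+n] m n

[1+m]∸n≤1+m∸n : ∀ m n → suc m ∸ n ≤ suc (m ∸ n)
[1+m]∸n≤1+m∸n m       zero    = ≤-refl
[1+m]∸n≤1+m∸n zero    (suc n) = ≤-trans (≤-reflexive (0∸n≡0 n)) z≤n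
[1+m]∸n≤1+m∸n (suc m) (suc n) = [1+m]∸n≤1+m∸n m n

∣i-j∣≡1+d⇒neighbour : ∀ i j {d} → ∣ i - j ∣ ≡ suc d →
                       (∃[ j′ ] j ≡ suc j′ × ∣ i - j′ ∣ ≡ d) ⊎ (suc j ≤ i × ∣ i - suc j ∣ ≡ d)
∣i-j∣≡1+d⇒neighbour zero    (suc j) refl = inj₁ (j , refl , refl)
∣i-j∣≡1+d⇒neighbour (suc i) zero    refl = inj₂ (s≤s z≤n , ∣-∣-identityʳ i)
∣i-j∣≡1+d⇒neighbour (suc i) (suc j) ∣i-j∣≡1+d with ∣i-j∣≡1+d⇒neighbour i j ∣i-j∣≡1+d
... | inj₁ (j′ , refl , ∣i-j′∣≡d) = inj₁ (suc j′ , refl , ∣i-j′∣≡d)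
... | inj₂ (1+j≤i , ∣i-1+j∣≡d)   = inj₂ (s≤s 1+j≤i , ∣i-1+j∣≡d)

+-≡ᵇ-+ : ∀ a i j → (a + i ≡ᵇ a + j) ≡ (i ≡ᵇ j)
+-≡ᵇ-+ zero    i j = refl
+-≡ᵇ-+ (suc a) i j = +-≡ᵇ-+ a i j

T-not-≡ᵇ⇔≢ : ∀ x y → T (not (x ≡ᵇ y)) ⇔ x ≢ y
T-not-≡ᵇ⇔≢ x y with x ≡ᵇ y in x≡ᵇy
... | true  = mk⇔ (λ ()) (λ x≢y → x≢y (≡ᵇ⇒≡ x y (subst T (sym x≡ᵇy) _)))
... | false = mk⇔ (λ _ x≡y → subst T x≡ᵇy (≡⇒≡ᵇ x y x≡y)) _

-- c x keeps the vertex number x > D itself rather than its position in the clique.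
data Vertex : Set where
  u : ℕ → Vertex
  c : ℕ → Vertex

label : Vertex → ℕ
label (u i) = i
label (c x) = x

module Model (D k : ℕ) where

  vertex : ℕ → Vertex
  vertex i = if isPath D i then u i else c i

  joined : ℕ → Bool
  joined x = (x ∸ suc D) <ᵇ k

  -- The clique vertex x is adjacent to exactly u₀, …, u_(hub x) on the path.
  hub : ℕ → ℕ
  hub x = if joined x then 2 else 1

  adj : Vertex → Vertex → Bool
  adj (u i) (u j) = (suc i ≡ᵇ j) ∨ (suc j ≡ᵇ i)
  adj (u i) (c x) = pathClique D k i x
  adj (c x) (u j) = pathClique D k j x
  adj (c x) (c y) = not (x ≡ᵇ y)

  vertex-path : ∀ {t} → t ≤ D → vertex t ≡ u t
  vertex-path {t} t≤D with isPath D t in isPath≡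
  ... | true  = refl
  ... | false = contradiction (subst T isPath≡ (<⇒<ᵇ (s≤s t≤D))) id

  vertex-clique : ∀ {t} → D < t → vertex t ≡ c t
  vertex-clique {t} D<t with isPath D t in isPath≡
  ... | true  = contradiction (<ᵇ⇒< t (suc D) (subst T (sym isPath≡) _)) (<⇒≱ (s≤s D<t))
  ... | false = refl

  label-vertex : ∀ t → label (vertex t) ≡ t
  label-vertex t with isPath D t
  ... | true  = refl
  ... | false = refl

  adjℕ≡adj : ∀ i j → adjℕ D k i j ≡ adj (vertex i) (vertex j)
  adjℕ≡adj i j with isPath D i | isPath D j
  ... | true  | true  = refl
  ... | true  | false = refl
  ... | false | true  = refl
  ... | false | false = refl

  1≤hub : ∀ x → 1 ≤ hub x
  1≤hub x with joined x
  ... | true  = s≤s z≤n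
  ... | false = s≤s z≤n

  hub≤2 : ∀ x → hub x ≤ 2
  hub≤2 x with joined x
  ... | true  = ≤-refl
  ... | false = s≤s z≤n

  pathClique⇔≤hub : ∀ a x → T (pathClique D k a x) ⇔ a ≤ hub x
  pathClique⇔≤hub zero                x = mk⇔ (λ _ → z≤n) _
  pathClique⇔≤hub (suc zero)          x = mk⇔ (λ _ → 1≤hub x) _
  pathClique⇔≤hub (suc (suc zero))    x with joined x
  ... | true  = mk⇔ (λ _ → ≤-refl) _
  ... | false = mk⇔ (λ ()) (λ { (s≤s ()) })
  pathClique⇔≤hub (suc (suc (suc a))) x =
    mk⇔ (λ ()) (λ 3+a≤hub → contradiction (≤-trans 3+a≤hub (hub≤2 x)) λ { (s≤s (s≤s ())) })

  data _~_ : Vertex → Vertex → Set where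
    u-suc : ∀ {i} → u i ~ u (suc i)
    suc-u : ∀ {i} → u (suc i) ~ u i
    c-c   : ∀ {x y} → x ≢ y → c x ~ c y
    u-c   : ∀ {a x} → a ≤ hub x → u a ~ c x
    c-u   : ∀ {a x} → a ≤ hub x → c x ~ u a

  adj⇒~ : ∀ a b → T (adj a b) → a ~ b
  adj⇒~ (u i) (u j) uᵢ~uⱼ with to T-∨ uᵢ~uⱼ
  ... | inj₁ 1+i≡j with ≡ᵇ⇒≡ (suc i) j 1+i≡j
  ...   | refl = u-suc
  adj⇒~ (u i) (u j) uᵢ~uⱼ | inj₂ 1+j≡i with ≡ᵇ⇒≡ (suc j) i 1+j≡i
  ...   | refl = suc-u
  adj⇒~ (u a) (c x) t = u-c (to (pathClique⇔≤hub a x) t)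
  adj⇒~ (c x) (u a) t = c-u (to (pathClique⇔≤hub a x) t)
  adj⇒~ (c x) (c y) t = c-c (to (T-not-≡ᵇ⇔≢ x y) t)

  ~⇒adj : ∀ {a b} → a ~ b → T (adj a b)
  ~⇒adj (u-suc {i}) = from T-∨ (inj₁ (≡⇒≡ᵇ (suc i) (suc i) refl))
  ~⇒adj (suc-u {i}) = from T-∨ (inj₂ (≡⇒≡ᵇ (suc i) (suc i) refl))
  ~⇒adj (c-c {x} {y} x≢y) = from (T-not-≡ᵇ⇔≢ x y) x≢y
  ~⇒adj (u-c {a} {x} a≤hub) = from (pathClique⇔≤hub a x) a≤hub
  ~⇒adj (c-u {a} {x} a≤hub) = from (pathClique⇔≤hub a x) a≤hub

  distance : Vertex → Vertex → ℕ
  distance (u i) (u j) = ∣ i - j ∣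
  distance (u i) (c x) = suc (i ∸ hub x)
  distance (c x) (u j) = suc (j ∸ hub x)
  distance (c x) (c y) with x ≟ y
  ... | yes _ = 0
  ... | no  _ = 1

  distance-c-c≤1 : ∀ x y → distance (c x) (c y) ≤ 1
  distance-c-c≤1 x y with x ≟ y
  ... | yes _ = z≤n
  ... | no  _ = ≤-refl

  distance-self : ∀ a → distance a a ≡ 0
  distance-self (u i) = ∣n-n∣≡0 i
  distance-self (c x) with x ≟ x
  ... | yes _   = refl
  ... | no  x≢x = contradiction refl x≢x

  distance≡0⇒≡ : ∀ a b → distance a b ≡ 0 → a ≡ b
  distance≡0⇒≡ (u i) (u j) ∣i-j∣≡0 = cong u (∣m-n∣≡0⇒m≡n ∣i-j∣≡0)
  distance≡0⇒≡ (c x) (c y) d≡0 with x ≟ y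
  ... | yes refl = refl

  distance-~ : ∀ z {a b} → a ~ b → distance z b ≤ suc (distance z a)
  distance-~ (u i) (u-suc {j}) = ∣i-1+j∣≤1+∣i-j∣ i j
  distance-~ (u i) (suc-u {j}) = ∣i-j∣≤1+∣i-1+j∣ i j
  distance-~ (u i) (c-c {x} {y} _) = s≤s (begin
    i ∸ hub y        ≤⟨ ∸-monoʳ-≤ i (1≤hub y) ⟩
    i ∸ 1            ≤⟨ m∸n≤1+m∸[1+n] i 1 ⟩
    suc (i ∸ 2)      ≤⟨ s≤s (∸-monoʳ-≤ i (hub≤2 x)) ⟩
    suc (i ∸ hub x)  ∎)
    where open ≤-Reasoning
  distance-~ (u i) (u-c {a} {x} a≤hub) = s≤s (≤-trans (∸-monoʳ-≤ i a≤hub) (m∸n≤∣m-n∣ i a))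
  distance-~ (u i) (c-u {a} {x} a≤hub) = begin
    ∣ i - a ∣                ≤⟨ ∣m-n∣≤m⊔n i a ⟩
    i ⊔ a                    ≤⟨ ⊔-lub (m≤n+m∸n i (hub x)) (≤-trans a≤hub (m≤m+n (hub x) _)) ⟩
    hub x + (i ∸ hub x)      ≤⟨ +-monoˡ-≤ (i ∸ hub x) (hub≤2 x) ⟩
    suc (suc (i ∸ hub x))    ∎
    where open ≤-Reasoning
  distance-~ (c x) (u-suc {j}) = s≤s ([1+m]∸n≤1+m∸n j (hub x))
  distance-~ (c x) (suc-u {j}) = s≤s (m≤n⇒m≤1+n (∸-monoˡ-≤ (hub x) (n≤1+n j)))
  distance-~ (c x) (c-c {_} {y} _) = ≤-trans (distance-c-c≤1 x y) (s≤s z≤n)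
  distance-~ (c x) (u-c {_} {y} _) = ≤-trans (distance-c-c≤1 x y) (s≤s z≤n)
  distance-~ (c x) (c-u {a} {y} a≤hub) with x ≟ y
  ... | yes refl = ≤-reflexive (cong suc (m≤n⇒m∸n≡0 a≤hub))
  ... | no  _    = s≤s (∸-mono (≤-trans a≤hub (hub≤2 y)) (1≤hub x))

module Invariants (D k m : ℕ) (2≤D : 2 ≤ D) where
  open Model D k public

  n : ℕ
  n = suc (D + m)

  D<n : D < n
  D<n = s≤s (m≤m+n D m)

  data Valid : Vertex → Set where
    onPath   : ∀ {i} → i ≤ D → Valid (u i)
    inClique : ∀ {x} → D < x → x < n → Valid (c x)

  predecessor : ∀ {z y d} → Valid z → Valid y → distance z y ≡ suc d →
                ∃[ x ] Valid x × x ~ y × distance z x ≡ d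
  predecessor {u i} {u j} (onPath i≤D) (onPath j≤D) ∣i-j∣≡1+d
    with ∣i-j∣≡1+d⇒neighbour i j ∣i-j∣≡1+d
  ... | inj₁ (j′ , refl , ∣i-j′∣≡d) = u j′ , onPath (<⇒≤ j≤D) , u-suc , ∣i-j′∣≡d
  ... | inj₂ (1+j≤i , ∣i-1+j∣≡d)   = u (suc j) , onPath (≤-trans 1+j≤i i≤D) , suc-u , ∣i-1+j∣≡d
  predecessor {u i} {c x} zᵥ _ refl with i ≤? hub x
  ... | yes i≤hub = u i , zᵥ , u-c i≤hub , trans (∣n-n∣≡0 i) (sym (m≤n⇒m∸n≡0 i≤hub))
  ... | no  i≰hub =
    u (hub x) , onPath (≤-trans (hub≤2 x) 2≤D) , u-c ≤-refl , m≤n⇒∣n-m∣≡n∸m (<⇒≤ (≰⇒> i≰hub))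
  predecessor {c x} {u a} zᵥ (onPath a≤D) refl with a ≤? hub x
  ... | yes a≤hub = c x , zᵥ , c-u a≤hub , trans (distance-self (c x)) (sym (m≤n⇒m∸n≡0 a≤hub))
  predecessor {c x} {u zero}    zᵥ _ refl | no 0≰hub = contradiction z≤n 0≰hub
  predecessor {c x} {u (suc a)} zᵥ (onPath 1+a≤D) refl | no  1+a≰hub =
    u a , onPath (<⇒≤ 1+a≤D) , u-suc , sym (+-∸-assoc 1 (≤-pred (≰⇒> 1+a≰hub)))
  predecessor {c x} {c y} zᵥ _ d[x,y]≡1+d with x ≟ y
  predecessor {c x} {c y} {zero} zᵥ _ refl | no x≢y = c x , zᵥ , c-c x≢y , distance-self (c x)

  valid-vertex : ∀ {t} → t < n → Valid (vertex t)
  valid-vertex {t} t<n with t ≤? D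
  ... | yes t≤D = subst Valid (sym (vertex-path t≤D)) (onPath t≤D)
  ... | no  t≰D = subst Valid (sym (vertex-clique (≰⇒> t≰D))) (inClique (≰⇒> t≰D) t<n)

  vertex-label : ∀ {a} → Valid a → vertex (label a) ≡ a
  vertex-label (onPath i≤D)   = vertex-path i≤D
  vertex-label (inClique D<x _) = vertex-clique D<x

  label<n : ∀ {a} → Valid a → label a < n
  label<n (onPath i≤D)   = ≤-<-trans i≤D D<n
  label<n (inClique _ x<n) = x<n

  eccentricity : Vertex → ℕ
  eccentricity a = maxTo (λ t → distance a (vertex t)) n

  distance-u≤ : ∀ {i b} → Valid b → distance (u i) b ≤ i ⊔ (D ∸ i)
  distance-u≤ {i} (onPath {j} j≤D) with ∣m-n∣≡[m∸n]∨[n∸m] i j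
  ... | inj₁ ∣i-j∣≡i∸j = ≤-trans (≤-reflexive ∣i-j∣≡i∸j) (≤-trans (m∸n≤m i j) (m≤m⊔n i _))
  ... | inj₂ ∣i-j∣≡j∸i = ≤-trans (≤-reflexive ∣i-j∣≡j∸i) (≤-trans (∸-monoˡ-≤ i j≤D) (m≤n⊔m i _))
  distance-u≤ {zero}  (inClique {x} _ _) = ≤-trans (s≤s (≤-reflexive (0∸n≡0 (hub x)))) (<⇒≤ 2≤D)
  distance-u≤ {suc i} (inClique {x} _ _) =
    ≤-trans (s≤s (∸-monoʳ-≤ (suc i) (1≤hub x))) (m≤m⊔n (suc i) (D ∸ suc i))

  distance-c≤ : ∀ {x b} → Valid b → distance (c x) b ≤ suc (D ∸ hub x)
  distance-c≤ {x} (onPath j≤D)       = s≤s (∸-monoˡ-≤ (hub x) j≤D)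
  distance-c≤ {x} (inClique {y} _ _) = ≤-trans (distance-c-c≤1 x y) (s≤s z≤n)

  distance-path≤eccentricity : ∀ a {t} → t ≤ D → distance a (u t) ≤ eccentricity a
  distance-path≤eccentricity a t≤D =
    subst (λ b → distance a b ≤ eccentricity a) (vertex-path t≤D)
          (maxTo-upper n (λ t → distance a (vertex t)) (≤-<-trans t≤D D<n))

  eccentricity-u : ∀ {i} → i ≤ D → eccentricity (u i) ≡ i ⊔ (D ∸ i)
  eccentricity-u {i} i≤D = ≤-antisym
    (maxTo-least n _ (λ t t<n → distance-u≤ {i} (valid-vertex t<n)))
    (⊔-lub (subst (_≤ eccentricity (u i)) (∣-∣-identityʳ i) (distance-path≤eccentricity (u i) z≤n))
           (subst (_≤ eccentricity (u i)) (m≤n⇒∣m-n∣≡n∸m i≤D) (distance-path≤eccentricity (u i) ≤-refl)))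

  eccentricity-c : ∀ x → eccentricity (c x) ≡ suc (D ∸ hub x)
  eccentricity-c x = ≤-antisym
    (maxTo-least n _ (λ t t<n → distance-c≤ {x} (valid-vertex t<n)))
    (distance-path≤eccentricity (c x) ≤-refl)

  eccentricity≤D : ∀ {a} → Valid a → eccentricity a ≤ D
  eccentricity≤D (onPath {i} i≤D) =
    ≤-trans (≤-reflexive (eccentricity-u i≤D)) (⊔-lub i≤D (m∸n≤m D i))
  eccentricity≤D (inClique {x} _ _) =
    ≤-trans (≤-reflexive (eccentricity-c x)) (∸-monoʳ-< {D} (1≤hub x) (≤-trans (hub≤2 x) 2≤D))

  vertex-fromℕ< : ∀ {a} (aᵥ : Valid a) → vertex (toℕ (fromℕ< (label<n aᵥ))) ≡ a
  vertex-fromℕ< aᵥ = trans (cong vertex (toℕ-fromℕ< (label<n aᵥ))) (vertex-label aᵥ)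

  dist-Gndk : ∀ v w → dist (Gndk n D k) v w ≡ distance (vertex (toℕ v)) (vertex (toℕ w))
  dist-Gndk v w = dist≡δ w (≤-<-trans (≤-trans δw≤ecc (eccentricity≤D vᵥ)) D<n)
    where
    vᵥ : Valid (vertex (toℕ v))
    vᵥ = valid-vertex (toℕ<n v)

    δ : Fin n → ℕ
    δ w = distance (vertex (toℕ v)) (vertex (toℕ w))

    δw≤ecc : δ w ≤ eccentricity (vertex (toℕ v))
    δw≤ecc = maxTo-upper n (λ t → distance (vertex (toℕ v)) (vertex t)) (toℕ<n w)

    δ≡0⇒source : ∀ w → δ w ≡ 0 → v ≡ w
    δ≡0⇒source w δw≡0 =
      toℕ-injective (begin
        toℕ v                  ≡⟨ label-vertex (toℕ v) ⟨
        label (vertex (toℕ v)) ≡⟨ cong label (distance≡0⇒≡ (vertex (toℕ v)) (vertex (toℕ w)) δw≡0) ⟩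
        label (vertex (toℕ w)) ≡⟨ label-vertex (toℕ w) ⟩
        toℕ w                  ∎)
      where open ≡-Reasoning

    δ-edge : ∀ x w → T (Gndk n D k x w) → δ w ≤ suc (δ x)
    δ-edge x w x~w = distance-~ (vertex (toℕ v)) (adj⇒~ _ _ (subst T (adjℕ≡adj (toℕ x) (toℕ w)) x~w))

    δ-predecessor : ∀ w d → δ w ≡ suc d → ∃[ x ] T (Gndk n D k x w) × δ x ≡ d
    δ-predecessor w d δw≡1+d with predecessor vᵥ (valid-vertex (toℕ<n w)) δw≡1+d
    ... | a , aᵥ , a~w , d[v,a]≡d =
      fromℕ< (label<n aᵥ) ,
      subst T (sym (adjℕ≡adj (toℕ (fromℕ< (label<n aᵥ))) (toℕ w)))
              (~⇒adj (subst (_~ vertex (toℕ w)) (sym (vertex-fromℕ< aᵥ)) a~w)) ,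
      trans (cong (distance (vertex (toℕ v))) (vertex-fromℕ< aᵥ)) d[v,a]≡d

    open DistanceCharacterisation (Gndk n D k) v δ (distance-self (vertex (toℕ v)))
                                  δ≡0⇒source δ-edge δ-predecessor

  ecc-Gndk : ∀ v → ecc (Gndk n D k) v ≡ eccentricity (vertex (toℕ v))
  ecc-Gndk v =
    foldr-⊔-tabulate n id (dist (Gndk n D k) v) (λ t → distance (vertex (toℕ v)) (vertex t)) (dist-Gndk v)

  degree : ℕ → ℕ
  degree t = sumTo (λ t′ → [ adjℕ D k t t′ ]) n

  deg-Gndk : ∀ v → deg (Gndk n D k) v ≡ degree (toℕ v)
  deg-Gndk v =
    sum-tabulate n id (λ w → [ Gndk n D k v w ]) (λ t → [ adjℕ D k (toℕ v) t ]) (λ _ → refl)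

  ξc-Gndk : ξc (Gndk n D k) ≡ sumTo (λ t → degree t * eccentricity (vertex t)) n
  ξc-Gndk = sum-tabulate n id (λ v → deg (Gndk n D k) v * ecc (Gndk n D k) v)
              (λ t → degree t * eccentricity (vertex t)) (λ v → cong₂ _*_ (deg-Gndk v) (ecc-Gndk v))

  pathNeighbours cliqueNeighbours : Vertex → ℕ
  pathNeighbours   a = sumTo (λ t → [ adj a (u t) ]) (suc D)
  cliqueNeighbours a = sumTo (λ j → [ adj a (c (suc D + j)) ]) m

  degree-split : ∀ t → degree t ≡ pathNeighbours (vertex t) + cliqueNeighbours (vertex t)
  degree-split t = trans (sumTo-+ˡ (suc D) m (λ t′ → [ adjℕ D k t t′ ])) (cong₂ _+_
    (sumTo-cong (suc D) λ t′ t′<1+D → cong [_] (trans (adjℕ≡adj t t′)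
                                                (cong (adj (vertex t)) (vertex-path (≤-pred t′<1+D)))))
    (sumTo-cong m λ j _ → cong [_] (trans (adjℕ≡adj t (suc D + j))
                                     (cong (adj (vertex t)) (vertex-clique (s≤s (m≤m+n D j)))))))

  degree-u : ∀ {t} → t ≤ D → degree t ≡ pathNeighbours (u t) + cliqueNeighbours (u t)
  degree-u {t} t≤D =
    trans (degree-split t) (cong (λ a → pathNeighbours a + cliqueNeighbours a) (vertex-path t≤D))

  degree-c : ∀ {x} → D < x → degree x ≡ pathNeighbours (c x) + cliqueNeighbours (c x)
  degree-c {x} D<x =
    trans (degree-split x) (cong (λ a → pathNeighbours a + cliqueNeighbours a) (vertex-clique D<x))

-- Writing D = 2 + d lets sums over the path unfold past u₀, u₁ and u₂ by computation.
module Contributions (d m : ℕ) where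
  D n : ℕ
  D = suc (suc d)
  n = suc (D + m)

  module G (k : ℕ) = Invariants D k m (s≤s (s≤s z≤n))
  open G using (degree; pathNeighbours; cliqueNeighbours; eccentricity)

  extraAtU₂ : ℕ → ℕ → ℕ
  extraAtU₂ k t = if t ≡ᵇ 2 then k else 0

  cliqueNeighbours-u : ∀ k → k ≤ m → ∀ t →
                       cliqueNeighbours k (u t) ≡ cliqueNeighbours 0 (u t) + extraAtU₂ k t
  cliqueNeighbours-u k k≤m zero                = sym (+-identityʳ _)
  cliqueNeighbours-u k k≤m (suc zero)          = sym (+-identityʳ _)
  cliqueNeighbours-u k k≤m (suc (suc zero))    = begin
    sumTo (λ j → [ (suc D + j) ∸ suc D <ᵇ k ]) m  ≡⟨ sumTo-cong m (λ j _ → cong (λ i → [ i <ᵇ k ]) (m+n∸m≡n (suc D) j)) ⟩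
    sumTo (λ j → [ j <ᵇ k ]) m                    ≡⟨ sumTo-<ᵇ k≤m ⟩
    k                                             ≡⟨ cong (_+ k) (sumTo-zero m) ⟨
    sumTo (λ _ → 0) m + k                         ∎
    where open ≡-Reasoning
  cliqueNeighbours-u k k≤m (suc (suc (suc t))) = sym (+-identityʳ _)

  -- The edges along the path do not involve k: pathNeighbours k (u t) is pathNeighbours 0 (u t).
  degree-path : ∀ k → k ≤ m → ∀ {t} → t ≤ D → degree k t ≡ degree 0 t + extraAtU₂ k t
  degree-path k k≤m {t} t≤D = begin
    degree k t                                                          ≡⟨ G.degree-u k t≤D ⟩
    pathNeighbours 0 (u t) + cliqueNeighbours k (u t)                   ≡⟨ cong (P +_) (cliqueNeighbours-u k k≤m t) ⟩
    pathNeighbours 0 (u t) + (cliqueNeighbours 0 (u t) + extraAtU₂ k t) ≡⟨ +-assoc P _ _ ⟨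
    pathNeighbours 0 (u t) + cliqueNeighbours 0 (u t) + extraAtU₂ k t   ≡⟨ cong (_+ extraAtU₂ k t) (G.degree-u 0 t≤D) ⟨
    degree 0 t + extraAtU₂ k t                                          ∎
    where
    open ≡-Reasoning
    P : ℕ
    P = pathNeighbours 0 (u t)

  degree-clique : ∀ k {j} → j < m → degree k (suc D + j) ≡ (if j <ᵇ k then suc (suc m) else suc m)
  degree-clique k {j} j<m = begin
    degree k x                                         ≡⟨ G.degree-c k (s≤s (m≤m+n D j)) ⟩
    pathNeighbours k (c x) + cliqueNeighbours k (c x)  ≡⟨ cong₂ _+_ path-part clique-part ⟩
    2 + [ j <ᵇ k ] + sumTo (λ i → [ not (j ≡ᵇ i) ]) m  ≡⟨ total (j <ᵇ k) ⟩
    (if j <ᵇ k then suc (suc m) else suc m)            ∎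
    where
    open ≡-Reasoning
    x : ℕ
    x = suc D + j

    path-part : pathNeighbours k (c x) ≡ 2 + [ j <ᵇ k ]
    path-part = cong (2 +_) (trans (cong₂ _+_ (cong (λ i → [ i <ᵇ k ]) (m+n∸m≡n (suc D) j)) (sumTo-zero d))
                                   (+-identityʳ _))

    clique-part : cliqueNeighbours k (c x) ≡ sumTo (λ i → [ not (j ≡ᵇ i) ]) m
    clique-part = sumTo-cong m (λ i _ → cong (λ b → [ not b ]) (+-≡ᵇ-+ (suc D) j i))

    total : ∀ b → 2 + [ b ] + sumTo (λ i → [ not (j ≡ᵇ i) ]) m ≡ (if b then suc (suc m) else suc m)
    total true  = cong (2 +_) (1+sumTo-≢ j<m)
    total false = cong suc (1+sumTo-≢ j<m)

  pathContribution₀ : ℕ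
  pathContribution₀ = sumTo (λ t → degree 0 t * (t ⊔ (D ∸ t))) (suc D)

  path-contribution : ∀ k → k ≤ m →
    sumTo (λ t → degree k t * eccentricity k (G.vertex k t)) (suc D) ≡ pathContribution₀ + k * (2 ⊔ d)
  path-contribution k k≤m = begin
    sumTo (λ t → degree k t * eccentricity k (G.vertex k t)) (suc D)
      ≡⟨ sumTo-cong (suc D) split ⟩
    sumTo (λ t → P₀ t + E t) (suc D)
      ≡⟨ sumTo-+ (suc D) P₀ E ⟩
    pathContribution₀ + sumTo E (suc D)
      ≡⟨ cong (pathContribution₀ +_) (trans (cong (k * (2 ⊔ d) +_) (sumTo-zero d)) (+-identityʳ _)) ⟩
    pathContribution₀ + k * (2 ⊔ d)
      ∎
    where
    open ≡-Reasoning
    P₀ E : ℕ → ℕ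
    P₀ t = degree 0 t * (t ⊔ (D ∸ t))
    E  t = extraAtU₂ k t * (t ⊔ (D ∸ t))

    split : ∀ t → t < suc D → degree k t * eccentricity k (G.vertex k t) ≡ P₀ t + E t
    split t t<1+D = trans
      (cong₂ _*_ (degree-path k k≤m (≤-pred t<1+D))
                 (trans (cong (eccentricity k) (G.vertex-path k (≤-pred t<1+D))) (G.eccentricity-u k (≤-pred t<1+D))))
      (*-distribʳ-+ (t ⊔ (D ∸ t)) (degree 0 t) _)

  joinedTerm unjoinedTerm : ℕ
  joinedTerm   = suc (suc m) * suc d
  unjoinedTerm = suc m * D

  clique-contribution : ∀ k → k ≤ m →
    sumTo (λ j → degree k (suc D + j) * eccentricity k (G.vertex k (suc D + j))) m
      ≡ k * joinedTerm + (m ∸ k) * unjoinedTerm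
  clique-contribution k k≤m = trans (sumTo-cong m term) (sumTo-if-<ᵇ joinedTerm unjoinedTerm k≤m)
    where
    term-by : ∀ b → (if b then suc (suc m) else suc m) * suc (D ∸ (if b then 2 else 1))
                      ≡ (if b then joinedTerm else unjoinedTerm)
    term-by true  = refl
    term-by false = refl

    term : ∀ j → j < m → degree k (suc D + j) * eccentricity k (G.vertex k (suc D + j))
                           ≡ (if j <ᵇ k then joinedTerm else unjoinedTerm)
    term j j<m = trans
      (cong₂ _*_ (degree-clique k j<m)
                 (trans (cong (eccentricity k) (G.vertex-clique k (s≤s (m≤m+n D j))))
                        (trans (G.eccentricity-c k (suc D + j))
                               (cong (λ i → suc (D ∸ (if i <ᵇ k then 2 else 1))) (m+n∸m≡n (suc D) j)))))
      (term-by (j <ᵇ k))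

  ξc-formula : ∀ k → k ≤ m →
    ξc (Gndk n D k) ≡ pathContribution₀ + k * (2 ⊔ d) + (k * joinedTerm + (m ∸ k) * unjoinedTerm)
  ξc-formula k k≤m = begin
    ξc (Gndk n D k)                                  ≡⟨ G.ξc-Gndk k ⟩
    sumTo F n                                        ≡⟨ sumTo-+ˡ (suc D) m F ⟩
    sumTo F (suc D) + sumTo (λ j → F (suc D + j)) m  ≡⟨ cong₂ _+_ (path-contribution k k≤m) (clique-contribution k k≤m) ⟩
    pathContribution₀ + k * (2 ⊔ d) + (k * joinedTerm + (m ∸ k) * unjoinedTerm) ∎
    where
    open ≡-Reasoning
    F : ℕ → ℕ
    F t = degree k t * eccentricity k (G.vertex k t)

ξc-increment : ∀ e m k → suc k ≤ m → let open Contributions (suc (suc e)) m in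
               ξc (Gndk n D (suc k)) + n ≡ ξc (Gndk n D k) + 3 * (D ∸ 1)
ξc-increment e (suc m) k (s≤s k≤m) = begin
  ξc (Gndk n D (suc k)) + n                                  ≡⟨ cong (_+ n) (ξc-formula (suc k) (s≤s k≤m)) ⟩
  P + suc k * (2 + e) + (suc k * J + (m ∸ k) * U) + n         ≡⟨ rearrange P k e m (m ∸ k) ⟩
  P + k * (2 + e) + (k * J + suc (m ∸ k) * U) + 3 * (3 + e)   ≡⟨ cong (λ r → P + k * (2 + e) + (k * J + r * U) + 3 * (3 + e))
                                                                      (+-∸-assoc 1 k≤m) ⟨
  P + k * (2 + e) + (k * J + (suc m ∸ k) * U) + 3 * (3 + e)   ≡⟨ cong (_+ 3 * (3 + e)) (ξc-formula k (m≤n⇒m≤1+n k≤m)) ⟨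
  ξc (Gndk n D k) + 3 * (D ∸ 1)                              ∎
  where
  open Contributions (suc (suc e)) (suc m)
    renaming (pathContribution₀ to P; joinedTerm to J; unjoinedTerm to U)
  open ≡-Reasoning
  rearrange : ∀ P k e m r →
    P + suc k * (2 + e) + (suc k * ((3 + m) * (3 + e)) + r * ((2 + m) * (4 + e))) + suc (4 + e + suc m)
      ≡ P + k * (2 + e) + (k * ((3 + m) * (3 + e)) + suc r * ((2 + m) * (4 + e))) + 3 * (3 + e)
  rearrange = solve-∀

1+D+[n∸D∸1]≡n : ∀ {n D} → D < n → suc (D + (n ∸ D ∸ 1)) ≡ n
1+D+[n∸D∸1]≡n {suc n} {zero}  _         = refl
1+D+[n∸D∸1]≡n {suc n} {suc D} (s≤s D<n) = cong suc (1+D+[n∸D∸1]≡n D<n)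

-- Transported from the shape used in Contributions, so that Agda never has to compare two
-- ξc terms by unfolding them.
ξc-step : ∀ {n D} → 4 ≤ D → D < n → ∀ k → suc k ≤ n ∸ D ∸ 1 →
          ξc (Gndk n D (suc k)) + n ≡ ξc (Gndk n D k) + 3 * (D ∸ 1)
ξc-step {n} {D} 4≤D D<n = subst₂ Step n-shape D-shape (ξc-increment (D ∸ 4) (n ∸ D ∸ 1))
  where
  Step : ℕ → ℕ → Set
  Step n′ D′ = ∀ k → suc k ≤ n ∸ D ∸ 1 →
               ξc (Gndk n′ D′ (suc k)) + n′ ≡ ξc (Gndk n′ D′ k) + 3 * (D′ ∸ 1)

  D-shape : Contributions.D (suc (suc (D ∸ 4))) (n ∸ D ∸ 1) ≡ D
  D-shape = m+[n∸m]≡n 4≤D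

  n-shape : Contributions.n (suc (suc (D ∸ 4))) (n ∸ D ∸ 1) ≡ n
  n-shape = trans (cong (λ D′ → suc (D′ + (n ∸ D ∸ 1))) D-shape) (1+D+[n∸D∸1]≡n D<n)

corollary2 : (n D k : ℕ) → 5 ≤ n → 4 ≤ D → D ≤ n ∸ 1 → k ≤ n ∸ D ∸ 1 →
    ((n < 3 * (D ∸ 1)) → (ξc (Gndk n D k) ≡ f n D ⇔ k ≡ n ∸ D ∸ 1))
    × ((n > 3 * (D ∸ 1)) → (ξc (Gndk n D k) ≡ f n D ⇔ k ≡ 0))
    × ((n ≡ 3 * (D ∸ 1)) → ξc (Gndk n D k) ≡ f n D)
corollary2 (suc n) D k (s≤s _) 4≤D D≤n k≤m =
  (λ n<3[D∸1] → subst (λ M → ξ k ≡ M ⇔ k ≡ m) f≡maxTo (argmax-top n<3[D∸1] k≤m)) ,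
  (λ n>3[D∸1] → subst (λ M → ξ k ≡ M ⇔ k ≡ 0) f≡maxTo (argmax-bottom n>3[D∸1] k≤m)) ,
  (λ n≡3[D∸1] → trans (sym (maximum-constant n≡3[D∸1] k k≤m)) f≡maxTo)
  where
  m : ℕ
  m = suc n ∸ D ∸ 1

  ξ : ℕ → ℕ
  ξ j = ξc (Gndk (suc n) D j)

  open Progression ξ m (suc n) (3 * (D ∸ 1)) (ξc-step 4≤D (s≤s D≤n))

  f≡maxTo : maxTo ξ (suc m) ≡ f (suc n) D
  f≡maxTo = sym (foldr-⊔-applyUpTo (suc m) id ξ)
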